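{- If a graph $G$ is in the switching class of a threshold graph (i.e. $G$ is obtained from some threshold graph by switching with respect to some vertex subset), then $G$ is a restricted 2-threshold graph.
   Context: Graphs are finite and simple. A threshold graph is a graph in which every induced subgraph has an isolated vertex or a universal vertex. For $G=(V,E)$ and $S\subseteq V$, switching $G$ with respect to $S$ means: for every pair $\{u,v\}$ with $u\in S$, $v\notin S$, add the edge if absent and remove it if present; other pairs are unchanged. Switching generates an equivalence relation whose classes are switching classes. Consider black/white colorings of the vertices (any map). A graph is a restricted 2-threshold graph if for some black/white coloring there is an ordering $v_1,\ldots,v_n$ of its vertices and, for each $j\ge 2$, an operator $\otimes_b$ or $\otimes_w$ such that $v_j$ is adjacent among $v_1,\ldots,v_{j-1}$ exactly to the black vertices (if its operator is $\otimes_b$) or exactly to the white vertices (if $\otimes_w$). -}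

module Defs where

open import Data.Nat using (ℕ)
open import Data.Fin using (Fin; _<_)
open import Data.Bool using (Bool; true; false; not; if_then_else_; _xor_)
open import Data.Product using (Σ; ∃; _×_; _,_)
open import Data.Sum using (_⊎_)
open import Relation.Binary.PropositionalEquality using (_≡_)
open import Function.Bundles using (_↔_; Inverse)

record Graph (n : ℕ) : Set where
  field
    adj  : Fin n → Fin n → Bool
    sym  : ∀ u v → adj u v ≡ adj v u
    irr  : ∀ v → adj v v ≡ false
open Graph public

Subset : ℕ → Set
Subset n = Fin n → Bool

IsolatedIn : ∀ {n} → Graph n → Subset n → Fin n → Set
IsolatedIn G S v = ∀ u → S u ≡ true → u ≡ v ⊎ adj G v u ≡ false

UniversalIn : ∀ {n} → Graph n → Subset n → Fin n → Set
UniversalIn G S v = ∀ u → S u ≡ true → u ≡ v ⊎ adj G v u ≡ true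

IsThreshold : ∀ {n} → Graph n → Set
IsThreshold {n} G =
  (S : Subset n) → (∃ λ w → S w ≡ true) →
  ∃ λ v → S v ≡ true × (IsolatedIn G S v ⊎ UniversalIn G S v)

switchAdj : ∀ {n} → Subset n → Graph n → Fin n → Fin n → Bool
switchAdj S G u v = if S u xor S v then not (adj G u v) else adj G u v

-- G' is obtained from G by switching with respect to S
-- (stated pointwise on adjacency, so Graph records need not be compared).
SwitchOf : ∀ {n} → Graph n → Subset n → Graph n → Set
SwitchOf G S G' = ∀ u v → adj G' u v ≡ switchAdj S G u v

-- Colouring: true = black, false = white.
-- Ordering: bijection σ from positions to vertices (v_j = σ j).
-- Operator at position j: true = ⊗_b, false = ⊗_w (value at position 0 unused).
IsRestricted2Threshold : ∀ {n} → Graph n → Set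
IsRestricted2Threshold {n} G =
  Σ (Fin n → Bool) λ colour →
  Σ (Fin n ↔ Fin n) λ σ →
  Σ (Fin n → Bool) λ op →
    let v = Inverse.to σ in
    ∀ (i j : Fin n) → i < j →
      adj G (v j) (v i) ≡ (if op j then colour (v i) else not (colour (v i)))

-- A *construction order* of a graph H is an ordering v₁, …, vₙ of its
-- vertices in which every vⱼ is adjacent either to all or to none of
-- v₁, …, vⱼ₋₁.  The proof has two independent halves.
--
--  * Threshold graphs have construction orders: repeatedly remove an
--    isolated or universal vertex of the remaining induced subgraph.
--    The removal sequence ("peeling") lists each vertex before all the
--    vertices it is uniform towards, so reading it backwards gives a
--    construction order.
--  * Switching a graph with a construction order with respect to S gives a
--    restricted 2-threshold graph: colour the vertices by S; switching flips
--    vⱼvᵢ exactly when S separates vⱼ and vᵢ, so vⱼ is adjacent to the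
--    earlier vertices of one fixed colour, determined by S(vⱼ) and by
--    whether vⱼ was joined to all or to none of its predecessors.
module Submission where

open import Defs hiding (sym)
open import Data.Nat using (ℕ; suc; s≤s) renaming (_≤_ to _≤ℕ_)
open import Data.Nat.Properties using (≤-trans; ≤-pred; ≤-reflexive; ∸-monoʳ-<)
open import Data.Fin using (Fin; _<_; cast; opposite; _≟_)
open import Data.Fin.Properties
  using (cantor-schröder-bernstein; opposite-prop; opposite-involutive;
         cast-involutive; toℕ-cast; toℕ<n)
open import Data.Bool using (Bool; true; false; not; if_then_else_; _xor_)
open import Data.Product using (∃; _×_; _,_; proj₁; proj₂)
open import Data.Sum using (_⊎_; inj₁; inj₂; [_,_]′)
open import Data.Empty using (⊥-elim)
open import Data.List using (List; []; _∷_; length; lookup; filter; allFin)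
open import Data.List.Properties using (filter-notAll; length-tabulate)
open import Data.List.Membership.Propositional using (_∈_)
open import Data.List.Membership.Propositional.Properties
  using (∈-filter⁺; ∈-filter⁻; ∈-allFin; ∈-lookup)
open import Data.List.Relation.Unary.Any as Any using (here; there; index)
open import Data.List.Relation.Unary.Any.Properties using (lookup-index)
open import Data.List.Relation.Unary.All as All using (All)
open import Data.List.Relation.Unary.AllPairs using ([]; _∷_)
open import Data.List.Relation.Unary.Unique.Propositional using (Unique)
open import Relation.Nullary using (Dec; yes; no; does; ¬?)
open import Relation.Nullary.Decidable using (dec-true)
open import Relation.Binary.PropositionalEquality
  using (_≡_; _≢_; refl; sym; cong; cong₂; module ≡-Reasoning)
open import Function using (_∘_; id; _↔_; Inverse; mk↔ₛ′)

does-true : ∀ {A : Set} (a? : Dec A) → does a? ≡ true → A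
does-true (yes a) _ = a
does-true (no _) ()

lookup-injective : ∀ {A : Set} {xs : List A} → Unique xs →
  ∀ a b → lookup xs a ≡ lookup xs b → a ≡ b
lookup-injective (_ ∷ _) Fin.zero Fin.zero _ = refl
lookup-injective (x∉ ∷ _) Fin.zero (Fin.suc b) eq = ⊥-elim (All.lookup x∉ (∈-lookup b) eq)
lookup-injective (x∉ ∷ _) (Fin.suc a) Fin.zero eq = ⊥-elim (All.lookup x∉ (∈-lookup a) (sym eq))
lookup-injective (_ ∷ xs!) (Fin.suc a) (Fin.suc b) eq = cong Fin.suc (lookup-injective xs! a b eq)

reversedEnumeration : ∀ {n} (Q : List (Fin n)) → Unique Q → (∀ u → u ∈ Q) →
  ∃ λ (σ : Fin n ↔ Fin n) → ∃ λ (ρ : Fin n → Fin (length Q)) →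
    (∀ j → Inverse.to σ j ≡ lookup Q (ρ j)) × (∀ {i j} → i < j → ρ j < ρ i)
reversedEnumeration {n} Q Q! complete = mk↔ₛ′ to from to∘from from∘to , ρ , (λ _ → refl) , ρ-reverses
  where
  position : Fin n → Fin (length Q)
  position u = index (complete u)

  position-injective : ∀ u w → position u ≡ position w → u ≡ w
  position-injective u w eq = begin
    u                     ≡⟨ lookup-index (complete u) ⟩
    lookup Q (position u) ≡⟨ cong (lookup Q) eq ⟩
    lookup Q (position w) ≡⟨ lookup-index (complete w) ⟨
    w                     ∎
    where open ≡-Reasoning

  -- lookup Q and position are injections in opposite directions.
  length≡n : length Q ≡ n
  length≡n = cantor-schröder-bernstein
    (λ {a} {b} → lookup-injective Q! a b) (λ {u} {w} → position-injective u w)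

  ρ : Fin n → Fin (length Q)
  ρ j = cast (sym length≡n) (opposite j)

  to : Fin n → Fin n
  to j = lookup Q (ρ j)

  from : Fin n → Fin n
  from u = opposite (cast length≡n (position u))

  to∘from : ∀ u → to (from u) ≡ u
  to∘from u = begin
    lookup Q (cast (sym length≡n) (opposite (opposite (cast length≡n (position u)))))
      ≡⟨ cong (λ k → lookup Q (cast (sym length≡n) k)) (opposite-involutive _) ⟩
    lookup Q (cast (sym length≡n) (cast length≡n (position u)))
      ≡⟨ cong (lookup Q) (cast-involutive (sym length≡n) length≡n (position u)) ⟩
    lookup Q (position u)
      ≡⟨ lookup-index (complete u) ⟨
    u ∎
    where open ≡-Reasoning

  from∘to : ∀ j → from (to j) ≡ j
  from∘to j = begin
    opposite (cast length≡n (position (to j)))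
      ≡⟨ cong (λ k → opposite (cast length≡n k))
              (lookup-injective Q! _ _ (sym (lookup-index (complete (to j))))) ⟩
    opposite (cast length≡n (cast (sym length≡n) (opposite j)))
      ≡⟨ cong opposite (cast-involutive length≡n (sym length≡n) (opposite j)) ⟩
    opposite (opposite j)
      ≡⟨ opposite-involutive j ⟩
    j ∎
    where open ≡-Reasoning

  ρ-reverses : ∀ {i j} → i < j → ρ j < ρ i
  ρ-reverses {i} {j} i<j
    rewrite toℕ-cast (sym length≡n) (opposite j) | toℕ-cast (sym length≡n) (opposite i)
          | opposite-prop i | opposite-prop j
    = ∸-monoʳ-< (s≤s i<j) (toℕ<n j)

ConstructionOrder : ∀ {n} → Graph n → Set
ConstructionOrder {n} G = ∃ λ (σ : Fin n ↔ Fin n) → ∃ λ (c : Fin n → Bool) →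
  ∀ i j → i < j → adj G (Inverse.to σ j) (Inverse.to σ i) ≡ c j

module _ {n : ℕ} (H : Graph n) where

  open import Data.List.Membership.DecPropositional (_≟_ {n}) using (_∈?_)

  extremal⇒uniform : ∀ {S v} → IsolatedIn H S v ⊎ UniversalIn H S v →
    ∃ λ c → ∀ u → S u ≡ true → u ≢ v → adj H v u ≡ c
  extremal⇒uniform (inj₁ isolated) =
    false , λ u u∈S u≢v → [ ⊥-elim ∘ u≢v , id ]′ (isolated u u∈S)
  extremal⇒uniform (inj₂ universal) =
    true , λ u u∈S u≢v → [ ⊥-elim ∘ u≢v , id ]′ (universal u u∈S)

  uniformVertex : IsThreshold H → ∀ {x} L → x ∈ L →
    ∃ λ v → v ∈ L × ∃ λ c → ∀ {u} → u ∈ L → u ≢ v → adj H v u ≡ c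
  uniformVertex thr L x∈L with thr (λ u → does (u ∈? L)) (_ , dec-true (_ ∈? L) x∈L)
  ... | v , v∈L , extremal with extremal⇒uniform extremal
  ... | c , uniform =
    v , does-true (v ∈? L) v∈L , c , λ {u} u∈L → uniform u (dec-true (u ∈? L) u∈L)

  -- This is the order in which the threshold
  -- property lets us strip vertices off one at a time.
  data Peeling : List (Fin n) → Set where
    []  : Peeling []
    _∷_ : ∀ {v Q} → ∃ (λ c → All (λ w → adj H v w ≡ c) Q) → Peeling Q → Peeling (v ∷ Q)

  peelingColour : ∀ {Q} → Peeling Q → Fin (length Q) → Bool
  peelingColour ((c , _) ∷ _) Fin.zero = c
  peelingColour (_ ∷ p) (Fin.suc a) = peelingColour p a

  peeling-lookup : ∀ {Q} (p : Peeling Q) {a b} → a < b →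
    adj H (lookup Q a) (lookup Q b) ≡ peelingColour p a
  peeling-lookup ((_ , uniform) ∷ _) {Fin.zero} {Fin.suc b} _ = All.lookup uniform (∈-lookup b)
  peeling-lookup (_ ∷ p) {Fin.suc a} {Fin.suc b} (s≤s a<b) = peeling-lookup p a<b

  record PeelingOf (L : List (Fin n)) : Set where
    field
      order    : List (Fin n)
      covers   : ∀ {u} → u ∈ L → u ∈ order
      within   : ∀ {u} → u ∈ order → u ∈ L
      distinct : Unique order
      peeling  : Peeling order

  -- Every list of vertices of a threshold graph can be peeled: put a uniform
  -- vertex v first and peel the rest of L.  Removing v shortens the list, so
  -- the bound k on its length decreases.
  peel : IsThreshold H → ∀ k L → length L ≤ℕ k → PeelingOf L
  peel thr k [] _ =
    record { order = [] ; covers = λ () ; within = λ () ; distinct = [] ; peeling = [] }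
  peel thr (suc k) (x ∷ L) (s≤s |L|≤k) with uniformVertex thr (x ∷ L) (here refl)
  ... | v , v∈L , c , uniform = record
    { order    = v ∷ R.order
    ; covers   = covers
    ; within   = λ { (here refl) → v∈L ; (there u∈R) → proj₁ (removed u∈R) }
    ; distinct = All.tabulate (λ u∈R v≡u → proj₂ (removed u∈R) (sym v≡u)) ∷ R.distinct
    ; peeling  = (c , All.tabulate (λ u∈R → uniform (proj₁ (removed u∈R)) (proj₂ (removed u∈R))))
                 ∷ R.peeling
    }
    where
    notV : ∀ u → Dec (u ≢ v)
    notV u = ¬? (u ≟ v)

    shorter : length (filter notV (x ∷ L)) ≤ℕ k
    shorter = ≤-trans (≤-pred (filter-notAll notV (x ∷ L) (Any.map (λ { refl v≢v → v≢v refl }) v∈L)))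
                      |L|≤k

    module R = PeelingOf (peel thr k (filter notV (x ∷ L)) shorter)

    removed : ∀ {u} → u ∈ R.order → u ∈ x ∷ L × u ≢ v
    removed u∈R = ∈-filter⁻ notV {xs = x ∷ L} (R.within u∈R)

    covers : ∀ {u} → u ∈ x ∷ L → u ∈ v ∷ R.order
    covers {u} u∈L with u ≟ v
    ... | yes refl = here refl
    ... | no u≢v = there (R.covers (∈-filter⁺ notV u∈L u≢v))

  peeling⇒constructionOrder : PeelingOf (allFin n) → ConstructionOrder H
  peeling⇒constructionOrder P
    with reversedEnumeration (PeelingOf.order P) (PeelingOf.distinct P)
                             (λ u → PeelingOf.covers P (∈-allFin u))
  ... | σ , ρ , σ-at , ρ-reverses = σ , peelingColour peeling ∘ ρ , λ i j i<j → begin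
    adj H (Inverse.to σ j) (Inverse.to σ i)         ≡⟨ cong₂ (adj H) (σ-at j) (σ-at i) ⟩
    adj H (lookup order (ρ j)) (lookup order (ρ i)) ≡⟨ peeling-lookup peeling (ρ-reverses i<j) ⟩
    peelingColour peeling (ρ j)                     ∎
    where
    open PeelingOf P
    open ≡-Reasoning

  threshold⇒constructionOrder : IsThreshold H → ConstructionOrder H
  threshold⇒constructionOrder thr =
    peeling⇒constructionOrder (peel thr n (allFin n) (≤-reflexive (length-tabulate id)))

-- Switching flips the adjacency of two vertices exactly when S separates
-- them (s ≠ t).  Hence if the adjacency was c before switching, afterwards
-- it holds iff t is the colour selected by c and s.
switch-uniform : ∀ c s t →
  (if s xor t then not c else c) ≡ (if not (c xor s) then t else not t)
switch-uniform false false false = refl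
switch-uniform false false true  = refl
switch-uniform false true  false = refl
switch-uniform false true  true  = refl
switch-uniform true  false false = refl
switch-uniform true  false true  = refl
switch-uniform true  true  false = refl
switch-uniform true  true  true  = refl

-- Switching a graph that has a construction order yields a restricted
-- 2-threshold graph: colour by S, and give the j-th vertex the operator
-- selecting the colour it ends up adjacent to.
switching⇒restricted2Threshold : ∀ {n} (H G : Graph n) (S : Subset n) →
  ConstructionOrder H → SwitchOf H S G → IsRestricted2Threshold G
switching⇒restricted2Threshold H G S (σ , c , construction) switched =
  S , σ , (λ j → not (c j xor S (v j))) , λ i j i<j → begin
    adj G (v j) (v i)
      ≡⟨ switched (v j) (v i) ⟩
    (if S (v j) xor S (v i) then not (adj H (v j) (v i)) else adj H (v j) (v i))
      ≡⟨ cong (λ a → if S (v j) xor S (v i) then not a else a) (construction i j i<j) ⟩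
    (if S (v j) xor S (v i) then not (c j) else c j)
      ≡⟨ switch-uniform (c j) (S (v j)) (S (v i)) ⟩
    (if not (c j xor S (v j)) then S (v i) else not (S (v i)))
      ∎
  where
  v = Inverse.to σ
  open ≡-Reasoning

theorem6 : ∀ (n : ℕ) (H G : Graph n) (S : Subset n) →
    IsThreshold H → SwitchOf H S G → IsRestricted2Threshold G
theorem6 n H G S threshold switched =
  switching⇒restricted2Threshold H G S (threshold⇒constructionOrder H threshold) switched
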